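{- Let $k\ge 1$ be an integer. The bishop graph $B_{2k,2k}$ admits a proper edge-coloring with $\Delta(B_{2k,2k})$ colors in which some color appears on exactly $2$ edges; moreover, there is no proper edge-coloring of $B_{2k,2k}$ with $\Delta(B_{2k,2k})$ colors in which some color appears on exactly one edge.
   Context: The bishop graph $B_{m,n}$ has vertex set $\{(x,y):1\le x\le n,\ 1\le y\le m\}$, with $(x_1,y_1)$ adjacent to $(x_2,y_2)$ iff $|x_1-x_2|=|y_1-y_2|\ge 1$ (i.e., the two squares lie on a common diagonal of the $m\times n$ chessboard). $\Delta(G)$ denotes the maximum degree of $G$. -}

module Defs where

open import Data.Nat using (ℕ; _≤_; _≟_; _≤?_; _⊔_; ∣_-_∣)
open import Data.Fin using (Fin; toℕ)
open import Data.List using (List; length; filter; foldr; map; cartesianProduct; allFin)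
open import Data.Product using (_×_; _,_; Σ-syntax; ∃-syntax)
open import Data.Sum using (_⊎_)
open import Relation.Nullary using (¬_; Dec)
open import Relation.Nullary.Decidable using (_×-dec_)
open import Relation.Binary.PropositionalEquality using (_≡_)

-- Squares of the m × n board: (x , y) with x ∈ {0..n-1}, y ∈ {0..m-1}
-- (0-based version of 1 ≤ x ≤ n, 1 ≤ y ≤ m; adjacency is translation invariant).
Square : ℕ → ℕ → Set
Square m n = Fin n × Fin m

Adj : ∀ {m n} → Square m n → Square m n → Set
Adj (x₁ , y₁) (x₂ , y₂) =
  (∣ toℕ x₁ - toℕ x₂ ∣ ≡ ∣ toℕ y₁ - toℕ y₂ ∣) × (1 ≤ ∣ toℕ x₁ - toℕ x₂ ∣)

adj? : ∀ {m n} (u v : Square m n) → Dec (Adj u v)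
adj? (x₁ , y₁) (x₂ , y₂) =
  (∣ toℕ x₁ - toℕ x₂ ∣ ≟ ∣ toℕ y₁ - toℕ y₂ ∣) ×-dec (1 ≤? ∣ toℕ x₁ - toℕ x₂ ∣)

squares : ∀ m n → List (Square m n)
squares m n = cartesianProduct (allFin n) (allFin m)

degree : ∀ {m n} → Square m n → ℕ
degree {m} {n} v = length (filter (adj? v) (squares m n))

Δ : ℕ → ℕ → ℕ
Δ m n = foldr _⊔_ 0 (map degree (squares m n))

-- An edge coloring of B_{m,n} with d colors: a color for every (ordered)
-- adjacent pair, symmetric, so that it is a color of the unordered edge.
-- Values on non-adjacent pairs are irrelevant.
IsEdgeColoring : ∀ {m n d} → (Square m n → Square m n → Fin d) → Set
IsEdgeColoring {m} {n} c = ∀ (u v : Square m n) → Adj u v → c u v ≡ c v u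

IsProper : ∀ {m n d} → (Square m n → Square m n → Fin d) → Set
IsProper {m} {n} c = ∀ (u v w : Square m n) → Adj u v → Adj u w → ¬ (v ≡ w) → ¬ (c u v ≡ c u w)

ProperEdgeColoring : ℕ → ℕ → ℕ → Set
ProperEdgeColoring m n d =
  Σ[ c ∈ (Square m n → Square m n → Fin d) ] (IsEdgeColoring c × IsProper c)

SameEdge : ∀ {m n} → Square m n → Square m n → Square m n → Square m n → Set
SameEdge u v u' v' = (u ≡ u' × v ≡ v') ⊎ (u ≡ v' × v ≡ u')

ColorOnExactlyOneEdge : ∀ {m n d} → (Square m n → Square m n → Fin d) → Fin d → Set
ColorOnExactlyOneEdge {m} {n} c i =
  ∃[ u ] ∃[ v ] (Adj u v × c u v ≡ i ×
    (∀ (a b : Square m n) → Adj a b → c a b ≡ i → SameEdge a b u v))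

ColorOnExactlyTwoEdges : ∀ {m n d} → (Square m n → Square m n → Fin d) → Fin d → Set
ColorOnExactlyTwoEdges {m} {n} c i =
  ∃[ u ] ∃[ v ] ∃[ u' ] ∃[ v' ]
    (Adj u v × c u v ≡ i × Adj u' v' × c u' v' ≡ i × ¬ SameEdge u v u' v' ×
     (∀ (a b : Square m n) → Adj a b → c a b ≡ i → SameEdge a b u v ⊎ SameEdge a b u' v'))

module Submission where

-- In a proper colouring with Δ colours every colour occurs at every square of maximum degree. On a
-- board of even side no square is fixed by the reflections in the two middle lines, so a square of
-- maximum degree and its two mirror images are three squares of maximum degree, one of which is not
-- an end of the edge carrying a colour used only once.
--
-- For the colouring, every diagonal and every anti-diagonal is a complete graph, and y ↦ 2k - 1 - y
-- turns anti-diagonals into diagonals. A square lies on one line at even and one at odd distance from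
-- the main diagonal, so the two kinds of lines can be coloured from two palettes of 2k and 2k - 1
-- colours that overlap in only two colours, using the classical 1-factorisations of complete graphs.
-- The private colour 0 is spent on the edge joining the two central squares of each longest line.

open import Defs
open import Data.Nat
  using (ℕ; zero; suc; z≤n; s≤s; z<s; _≤_; _<_; _+_; _*_; _∸_; _⊔_; _⊓_; ∣_-_∣; _≟_; _<?_; NonZero; >-nonZero; parity)
open import Data.Nat.Properties
open import Data.Nat.DivMod using (_%_; _mod_; m%n<n; m<n⇒m%n≡m; m≤n⇒[n∸m]%m≡n%m; n%n≡0)
open import Data.Nat.Tactic.RingSolver using (solve-∀)
open import Data.Parity.Base as ℙ using (0ℙ; 1ℙ)
import Data.Parity.Properties as Parity
open import Data.Fin using (Fin; toℕ; fromℕ<; opposite; inject₁; punchIn) renaming (zero to fzero; suc to fsuc)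
import Data.Fin.Properties as Fin
open import Data.List using (List; []; _∷_; length; filter; foldr; map; allFin; tabulate; _++_)
open import Data.List.Properties using (length-map; length-tabulate; length-++; length-removeAt′)
open import Data.List.Membership.Propositional using (_∈_)
open import Data.List.Membership.Propositional.Properties
  using (∈-filter⁺; ∈-filter⁻; ∈-map⁺; ∈-map⁻; ∈-cartesianProduct⁺; ∈-allFin; ∈-tabulate⁻; ∈-++⁻)
open import Data.List.Relation.Binary.Subset.Propositional using (_⊆_)
open import Data.List.Relation.Unary.Any using (here; there; index; _─_)
open import Data.List.Relation.Unary.All using (All; []; _∷_)
import Data.List.Relation.Unary.All as All
import Data.List.Relation.Unary.All.Properties as All
open import Data.List.Relation.Unary.Unique.Propositional using (Unique; []; _∷_)
import Data.List.Relation.Unary.Unique.Propositional.Properties as Unique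
open import Data.Product using (_×_; _,_; Σ-syntax; ∃-syntax; proj₁; proj₂)
import Data.Product as Product
open import Data.Product.Properties using (≡-dec)
open import Data.Sum using (_⊎_; inj₁; inj₂)
import Data.Sum as Sum
open import Data.Empty using (⊥; ⊥-elim)
open import Function using (_∘_)
open import Relation.Nullary using (¬_; Dec; yes; no)
open import Relation.Nullary.Decidable using (_×-dec_; _⊎-dec_; map′)
open import Relation.Binary.Definitions using (DecidableEquality)
open import Relation.Binary.PropositionalEquality
  using (_≡_; _≢_; refl; sym; trans; cong; cong₂; subst; ≢-sym; module ≡-Reasoning)

module _ {A : Set} where

  ∈-─ : ∀ {x z : A} {ys} (x∈ys : x ∈ ys) → z ∈ ys → z ≢ x → z ∈ (ys ─ x∈ys)
  ∈-─ (here refl) (here refl) z≢x = ⊥-elim (z≢x refl)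
  ∈-─ (here refl) (there z∈ys) _ = z∈ys
  ∈-─ (there _) (here refl) _ = here refl
  ∈-─ (there x∈ys) (there z∈ys) z≢x = there (∈-─ x∈ys z∈ys z≢x)

  Unique-⊆⇒length≤ : ∀ {xs ys : List A} → Unique xs → xs ⊆ ys → length xs ≤ length ys
  Unique-⊆⇒length≤ {[]} _ _ = z≤n
  Unique-⊆⇒length≤ {x ∷ xs} {ys} (x∉xs ∷ xs!) xs⊆ys = begin
    suc (length xs)          ≤⟨ s≤s (Unique-⊆⇒length≤ xs! xs⊆ys─x) ⟩
    suc (length (ys ─ x∈ys)) ≡⟨ length-removeAt′ ys (index x∈ys) ⟨
    length ys                ∎
    where
    open ≤-Reasoning
    x∈ys = xs⊆ys (here refl)
    xs⊆ys─x : xs ⊆ (ys ─ x∈ys)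
    xs⊆ys─x z∈xs = ∈-─ x∈ys (xs⊆ys (there z∈xs)) (λ z≡x → All.lookup x∉xs z∈xs (sym z≡x))

  Unique-map⁺ : ∀ {B : Set} (f : A → B) {xs} →
    (∀ {a b} → a ∈ xs → b ∈ xs → a ≢ b → f a ≢ f b) → Unique xs → Unique (map f xs)
  Unique-map⁺ f {[]} _ [] = []
  Unique-map⁺ f {x ∷ xs} f-inj (x∉xs ∷ xs!) =
    All.map⁺ (All.tabulate λ z∈xs → f-inj (here refl) (there z∈xs) (All.lookup x∉xs z∈xs))
    ∷ Unique-map⁺ f (λ a∈ b∈ → f-inj (there a∈) (there b∈)) xs!

  avoid-two : DecidableEquality A → ∀ a b c u v → a ≢ b → a ≢ c → b ≢ c →
    ∃[ w ] w ∈ a ∷ b ∷ c ∷ [] × w ≢ u × w ≢ v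
  avoid-two _≟A_ a b c u v a≢b a≢c b≢c with a ≟A u | a ≟A v
  ... | no a≢u | no a≢v = a , here refl , a≢u , a≢v
  ... | yes refl | _ with b ≟A v
  ...   | no b≢v   = b , there (here refl) , ≢-sym a≢b , b≢v
  ...   | yes refl = c , there (there (here refl)) , ≢-sym a≢c , ≢-sym b≢c
  avoid-two _≟A_ a b c u v a≢b a≢c b≢c | no _ | yes refl with b ≟A u
  ...   | no b≢u   = b , there (here refl) , b≢u , ≢-sym a≢b
  ...   | yes refl = c , there (there (here refl)) , ≢-sym b≢c , ≢-sym a≢c

≤-foldr-⊔ : ∀ {x xs} → x ∈ xs → x ≤ foldr _⊔_ 0 xs
≤-foldr-⊔ {xs = y ∷ ys} (here refl) = m≤m⊔n y _
≤-foldr-⊔ {xs = y ∷ ys} (there x∈ys) = ≤-trans (≤-foldr-⊔ x∈ys) (m≤n⊔m y _)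

foldr-⊔-∈ : ∀ xs → foldr _⊔_ 0 xs ≡ 0 ⊎ foldr _⊔_ 0 xs ∈ xs
foldr-⊔-∈ [] = inj₁ refl
foldr-⊔-∈ (y ∷ ys) with ⊔-sel y (foldr _⊔_ 0 ys) | foldr-⊔-∈ ys
... | inj₁ ⊔≡y | _ = inj₂ (here ⊔≡y)
... | inj₂ ⊔≡max | inj₁ max≡0 = inj₁ (trans ⊔≡max max≡0)
... | inj₂ ⊔≡max | inj₂ max∈ys = inj₂ (subst (_∈ y ∷ ys) (sym ⊔≡max) (there max∈ys))

∣-∣-complement : ∀ p q a b → p + a ≡ q + b → ∣ p - q ∣ ≡ ∣ b - a ∣
∣-∣-complement p q a b p+a≡q+b = begin
  ∣ p - q ∣                     ≡⟨ ∣m+n-m+o∣≡∣n-o∣ (a + b) p q ⟨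
  ∣ (a + b) + p - (a + b) + q ∣ ≡⟨ cong₂ ∣_-_∣ (regroup a b p) (regroup′ a b q) ⟩
  ∣ (p + a) + b - (q + b) + a ∣ ≡⟨ cong (λ z → ∣ z + b - (q + b) + a ∣) p+a≡q+b ⟩
  ∣ (q + b) + b - (q + b) + a ∣ ≡⟨ ∣m+n-m+o∣≡∣n-o∣ (q + b) b a ⟩
  ∣ b - a ∣                     ∎
  where
  open ≡-Reasoning
  regroup : ∀ a b p → (a + b) + p ≡ (p + a) + b
  regroup = solve-∀
  regroup′ : ∀ a b q → (a + b) + q ≡ (q + b) + a
  regroup′ = solve-∀

double-injective : ∀ a b → a + a ≡ b + b → a ≡ b
double-injective a b a+a≡b+b =
  *-cancelˡ-≡ a b 2 (trans (cong (a +_) (+-identityʳ a)) (trans a+a≡b+b (cong (b +_) (sym (+-identityʳ b)))))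

≢⇒1≤∣-∣ : ∀ {a b} → a ≢ b → 1 ≤ ∣ a - b ∣
≢⇒1≤∣-∣ {a} {b} a≢b = n≢0⇒n>0 (λ ∣a-b∣≡0 → a≢b (∣m-n∣≡0⇒m≡n ∣a-b∣≡0))

∣-∣-view : ∀ a b → a + ∣ a - b ∣ ≡ b ⊎ b + ∣ a - b ∣ ≡ a
∣-∣-view a b with ≤-total a b
... | inj₁ a≤b = inj₁ (trans (cong (a +_) (m≤n⇒∣m-n∣≡n∸m a≤b)) (m+[n∸m]≡n a≤b))
... | inj₂ b≤a = inj₂ (trans (cong (b +_) (m≤n⇒∣n-m∣≡n∸m b≤a)) (m+[n∸m]≡n b≤a))

+-translate : ∀ {a b a' b' d} → a + d ≡ a' → b + d ≡ b' → a + b' ≡ a' + b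
+-translate {a} {b} {d = d} a+d≡a' b+d≡b' =
  trans (cong (a +_) (sym b+d≡b')) (trans (+-translate-regroup a b d) (cong (_+ b) a+d≡a'))
  where
  +-translate-regroup : ∀ a b d → a + (b + d) ≡ (a + d) + b
  +-translate-regroup = solve-∀

parity[n+n]≡0ℙ : ∀ n → parity (n + n) ≡ 0ℙ
parity[n+n]≡0ℙ n = trans (Parity.+-homo-+ n n) (Parity.p+p≡0ℙ (parity n))

parity[1+n+n]≡1ℙ : ∀ n → parity (suc (n + n)) ≡ 1ℙ
parity[1+n+n]≡1ℙ n = trans (Parity.+-homo-+ 1 (n + n)) (cong (1ℙ ℙ.+_) (parity[n+n]≡0ℙ n))

parity[n+n+d]≡parity[d] : ∀ n d → parity ((n + n) + d) ≡ parity d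
parity[n+n+d]≡parity[d] n d = trans (Parity.+-homo-+ (n + n) d) (cong (ℙ._+ parity d) (parity[n+n]≡0ℙ n))

parity-∣-∣ : ∀ a b → parity ∣ a - b ∣ ≡ parity (a + b)
parity-∣-∣ a b with ∣-∣-view a b
... | inj₁ a+d≡b = sym (begin
  parity (a + b)                 ≡⟨ cong (λ z → parity (a + z)) a+d≡b ⟨
  parity (a + (a + ∣ a - b ∣))   ≡⟨ cong parity (+-assoc a a _) ⟨
  parity ((a + a) + ∣ a - b ∣)   ≡⟨ parity[n+n+d]≡parity[d] a _ ⟩
  parity ∣ a - b ∣               ∎)
  where open ≡-Reasoning
... | inj₂ b+d≡a = sym (begin
  parity (a + b)                 ≡⟨ cong (λ z → parity (z + b)) b+d≡a ⟨
  parity ((b + ∣ a - b ∣) + b)   ≡⟨ cong parity (regroup b _) ⟩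
  parity ((b + b) + ∣ a - b ∣)   ≡⟨ parity[n+n+d]≡parity[d] b _ ⟩
  parity ∣ a - b ∣               ∎)
  where
  open ≡-Reasoning
  regroup : ∀ b d → (b + d) + b ≡ (b + b) + d
  regroup = solve-∀

position< : ∀ r {i m} → i + r < r + m → i < m
position< r {i} {m} i+r<r+m = +-cancelʳ-< r i m (subst (i + r <_) (+-comm r m) i+r<r+m)

toℕ-opposite+suc : ∀ {n} (i : Fin n) → toℕ (opposite i) + suc (toℕ i) ≡ n
toℕ-opposite+suc i = trans (cong (_+ suc (toℕ i)) (Fin.opposite-prop i)) (m∸n+n≡m (Fin.toℕ<n i))

∣opposite-opposite∣ : ∀ {n} (a b : Fin n) → ∣ toℕ (opposite a) - toℕ (opposite b) ∣ ≡ ∣ toℕ a - toℕ b ∣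
∣opposite-opposite∣ a b = trans
  (∣-∣-complement (toℕ (opposite a)) (toℕ (opposite b)) (suc (toℕ a)) (suc (toℕ b))
    (trans (toℕ-opposite+suc a) (sym (toℕ-opposite+suc b))))
  (∣-∣-comm (toℕ b) (toℕ a))

opposite-injective : ∀ {n} {a b : Fin n} → opposite a ≡ opposite b → a ≡ b
opposite-injective {a = a} {b} opp-a≡opp-b =
  trans (sym (Fin.opposite-involutive a)) (trans (cong opposite opp-a≡opp-b) (Fin.opposite-involutive b))

opposite≢ : ∀ k (x : Fin (2 * k)) → opposite x ≢ x
opposite≢ k x opp-x≡x = even≢odd k (toℕ x) (begin
  2 * k                          ≡⟨ toℕ-opposite+suc x ⟨
  toℕ (opposite x) + suc (toℕ x) ≡⟨ cong (λ z → toℕ z + suc (toℕ x)) opp-x≡x ⟩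
  toℕ x + suc (toℕ x)            ≡⟨ +-suc (toℕ x) (toℕ x) ⟩
  suc (toℕ x + toℕ x)            ≡⟨ cong (λ z → suc (toℕ x + z)) (+-identityʳ (toℕ x)) ⟨
  suc (2 * toℕ x)                ∎)
  where open ≡-Reasoning

opposite-fixed-unique : ∀ {n} {a b : Fin n} → opposite a ≡ a → opposite b ≡ b → a ≡ b
opposite-fixed-unique {a = a} {b} opp-a≡a opp-b≡b =
  Fin.toℕ-injective (double-injective _ _ (suc-injective (begin
  suc (toℕ a + toℕ a)            ≡⟨ +-suc (toℕ a) (toℕ a) ⟨
  toℕ a + suc (toℕ a)            ≡⟨ cong (λ z → toℕ z + suc (toℕ a)) opp-a≡a ⟨
  toℕ (opposite a) + suc (toℕ a) ≡⟨ trans (toℕ-opposite+suc a) (sym (toℕ-opposite+suc b)) ⟩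
  toℕ (opposite b) + suc (toℕ b) ≡⟨ cong (λ z → toℕ z + suc (toℕ b)) opp-b≡b ⟩
  toℕ b + suc (toℕ b)            ≡⟨ +-suc (toℕ b) (toℕ b) ⟩
  suc (toℕ b + toℕ b)            ∎)))
  where open ≡-Reasoning

module _ {m n : ℕ} where

  _≟□_ : DecidableEquality (Square m n)
  _≟□_ = ≡-dec Fin._≟_ Fin._≟_

  ∈-squares : ∀ v → v ∈ squares m n
  ∈-squares (x , y) = ∈-cartesianProduct⁺ (∈-allFin x) (∈-allFin y)

  Unique-squares : Unique (squares m n)
  Unique-squares = Unique.cartesianProduct⁺ (Unique.allFin⁺ n) (Unique.allFin⁺ m)

  neighbours : Square m n → List (Square m n)
  neighbours v = filter (adj? v) (squares m n)

  Unique-neighbours : ∀ v → Unique (neighbours v)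
  Unique-neighbours v = Unique.filter⁺ (adj? v) Unique-squares

  ∈-neighbours⁻ : ∀ v {w} → w ∈ neighbours v → Adj v w
  ∈-neighbours⁻ v w∈ = proj₂ (∈-filter⁻ (adj? v) {xs = squares m n} w∈)

  degree≤Δ : ∀ v → degree v ≤ Δ m n
  degree≤Δ v = ≤-foldr-⊔ (∈-map⁺ degree (∈-squares v))

  Δ≡0⊎Δ-attained : Δ m n ≡ 0 ⊎ ∃[ v ] degree v ≡ Δ m n
  Δ≡0⊎Δ-attained with foldr-⊔-∈ (map degree (squares m n))
  ... | inj₁ Δ≡0 = inj₁ Δ≡0
  ... | inj₂ Δ∈ = let v , _ , Δ≡deg = ∈-map⁻ degree Δ∈ in inj₂ (v , sym Δ≡deg)

  degree-lowerBound : ∀ v {ws} → Unique ws → (∀ {w} → w ∈ ws → Adj v w) → length ws ≤ degree v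
  degree-lowerBound v ws! adj =
    Unique-⊆⇒length≤ ws! (λ {w} w∈ → ∈-filter⁺ (adj? v) (∈-squares w) (adj w∈))

  degree-mono : (σ : Square m n → Square m n) → (∀ {a b} → σ a ≡ σ b → a ≡ b) →
    (∀ a b → Adj a b → Adj (σ a) (σ b)) → ∀ v → degree v ≤ degree (σ v)
  degree-mono σ σ-inj σ-adj v = subst (_≤ degree (σ v)) (length-map σ (neighbours v))
    (degree-lowerBound (σ v) (Unique.map⁺ σ-inj (Unique-neighbours v)) adj)
    where
    adj : ∀ {w} → w ∈ map σ (neighbours v) → Adj (σ v) w
    adj w∈ = let a , a∈ , w≡σa = ∈-map⁻ σ w∈ in
      subst (Adj (σ v)) (sym w≡σa) (σ-adj v a (∈-neighbours⁻ v a∈))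

  missing-colour⇒degree< : ∀ {d} {c : Square m n → Square m n → Fin d} → IsProper c →
    ∀ w i → (∀ x → Adj w x → c w x ≢ i) → degree w < d
  missing-colour⇒degree< {d} {c} proper w i i-missing = begin-strict
    degree w                          ≡⟨ length-map (c w) (neighbours w) ⟨
    length (map (c w) (neighbours w)) <⟨ Unique-⊆⇒length≤ colours! (λ {z} _ → ∈-allFin z) ⟩
    length (allFin d)                 ≡⟨ length-tabulate (λ z → z) ⟩
    d                                 ∎
    where
    open ≤-Reasoning
    colours! : Unique (i ∷ map (c w) (neighbours w))
    colours! = All.map⁺ (All.tabulate λ {x} x∈ i≡c → i-missing x (∈-neighbours⁻ w x∈) (sym i≡c))
             ∷ Unique-map⁺ (c w) (λ a∈ b∈ → proper w _ _ (∈-neighbours⁻ w a∈) (∈-neighbours⁻ w b∈))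
                 (Unique-neighbours w)

  reflectˣ reflectʸ : Square m n → Square m n
  reflectˣ (x , y) = opposite x , y
  reflectʸ (x , y) = x , opposite y

  reflectˣ-injective : ∀ {a b} → reflectˣ a ≡ reflectˣ b → a ≡ b
  reflectˣ-injective ra≡rb = cong₂ _,_ (opposite-injective (cong proj₁ ra≡rb)) (cong proj₂ ra≡rb)

  reflectʸ-injective : ∀ {a b} → reflectʸ a ≡ reflectʸ b → a ≡ b
  reflectʸ-injective ra≡rb = cong₂ _,_ (cong proj₁ ra≡rb) (opposite-injective (cong proj₂ ra≡rb))

  reflectˣ-adj : ∀ a b → Adj a b → Adj (reflectˣ a) (reflectˣ b)
  reflectˣ-adj (x , _) (x' , _) (dx≡dy , 1≤dx) =
    trans (∣opposite-opposite∣ x x') dx≡dy , subst (1 ≤_) (sym (∣opposite-opposite∣ x x')) 1≤dx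

  reflectʸ-adj : ∀ a b → Adj a b → Adj (reflectʸ a) (reflectʸ b)
  reflectʸ-adj (_ , y) (_ , y') (dx≡dy , 1≤dx) = trans dx≡dy (sym (∣opposite-opposite∣ y y')) , 1≤dx

-- (c , c) is a central square of the board of side l + 2: it sees l + 1 squares on its diagonal and
-- l on its anti-diagonal.
degree-centre : ∀ {l} (c : Fin (suc l)) → opposite c ≡ c →
  suc l + l ≤ degree {suc (suc l)} {suc (suc l)} (inject₁ c , inject₁ c)
degree-centre {l} c opp-c≡c = begin
  suc l + l                ≡⟨ cong₂ _+_ (length-tabulate diagonal) (length-tabulate antidiagonal) ⟨
  length ds + length as    ≡⟨ length-++ ds ⟨
  length (ds ++ as)        ≤⟨ degree-lowerBound centre (Unique.++⁺ ds! as! disjoint) adjacent ⟩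
  degree centre            ∎
  where
  open ≤-Reasoning
  centre = inject₁ c , inject₁ c
  ∣c-x∣≡∣c-opposite-x∣ : ∀ x → ∣ toℕ c - toℕ x ∣ ≡ ∣ toℕ c - toℕ (opposite x) ∣
  ∣c-x∣≡∣c-opposite-x∣ x = begin-equality
    ∣ toℕ c - toℕ x ∣                       ≡⟨ ∣opposite-opposite∣ c x ⟨
    ∣ toℕ (opposite c) - toℕ (opposite x) ∣ ≡⟨ cong (λ z → ∣ toℕ z - toℕ (opposite x) ∣) opp-c≡c ⟩
    ∣ toℕ c - toℕ (opposite x) ∣            ∎
  ∣inject₁-inject₁∣ : ∀ (a b : Fin (suc l)) → ∣ toℕ (inject₁ a) - toℕ (inject₁ b) ∣ ≡ ∣ toℕ a - toℕ b ∣
  ∣inject₁-inject₁∣ a b = cong₂ ∣_-_∣ (Fin.toℕ-inject₁ a) (Fin.toℕ-inject₁ b)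
  diagonal : Fin (suc l) → Square (suc (suc l)) (suc (suc l))
  diagonal b = punchIn (inject₁ c) b , punchIn (inject₁ c) b
  antidiagonal : Fin l → Square (suc (suc l)) (suc (suc l))
  antidiagonal b = inject₁ (punchIn c b) , inject₁ (opposite (punchIn c b))
  ds = tabulate diagonal
  as = tabulate antidiagonal
  ds! : Unique ds
  ds! = Unique.tabulate⁺ {f = diagonal} λ eq → Fin.punchIn-injective (inject₁ c) _ _ (cong proj₁ eq)
  as! : Unique as
  as! = Unique.tabulate⁺ {f = antidiagonal} λ eq →
    Fin.punchIn-injective c _ _ (Fin.inject₁-injective (cong proj₁ eq))
  disjoint : ∀ {w} → ¬ (w ∈ ds × w ∈ as)
  disjoint (w∈ds , w∈as) with ∈-tabulate⁻ {f = diagonal} w∈ds | ∈-tabulate⁻ {f = antidiagonal} w∈as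
  ... | _ , refl | b , eq = Fin.punchInᵢ≢i c b (opposite-fixed-unique
        (sym (Fin.inject₁-injective (trans (sym (cong proj₁ eq)) (cong proj₂ eq)))) opp-c≡c)
  adjacent : ∀ {w} → w ∈ ds ++ as → Adj centre w
  adjacent w∈ with ∈-++⁻ ds w∈
  ... | inj₁ w∈ds with ∈-tabulate⁻ {f = diagonal} w∈ds
  ...   | b , refl = refl , ≢⇒1≤∣-∣ λ eq → Fin.punchInᵢ≢i (inject₁ c) b (Fin.toℕ-injective (sym eq))
  adjacent w∈ | inj₂ w∈as with ∈-tabulate⁻ {f = antidiagonal} w∈as
  ...   | b , refl = let x = punchIn c b in
    trans (∣inject₁-inject₁∣ c x) (trans (∣c-x∣≡∣c-opposite-x∣ x) (sym (∣inject₁-inject₁∣ c (opposite x)))) ,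
    subst (1 ≤_) (sym (∣inject₁-inject₁∣ c x))
      (≢⇒1≤∣-∣ λ eq → Fin.punchInᵢ≢i c b (Fin.toℕ-injective (sym eq)))

-- No colour on exactly one edge

no-colour-on-exactly-one-edge : ∀ a b →
  ¬ (Σ[ C ∈ ProperEdgeColoring (2 * a) (2 * b) (Δ (2 * a) (2 * b)) ]
       ∃[ i ] ColorOnExactlyOneEdge (proj₁ C) i)
no-colour-on-exactly-one-edge a b ((c , _ , proper) , i , u , v , _ , _ , only-uv) with Δ≡0⊎Δ-attained
... | inj₁ Δ≡0 = Fin.¬Fin0 (subst Fin Δ≡0 i)
... | inj₂ (w₀ , deg-w₀≡Δ)
  with avoid-two _≟□_ w₀ (reflectˣ w₀) (reflectʸ w₀) u v
         (λ w₀≡ → opposite≢ b (proj₁ w₀) (sym (cong proj₁ w₀≡)))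
         (λ w₀≡ → opposite≢ a (proj₂ w₀) (sym (cong proj₂ w₀≡)))
         (λ rw₀≡ → opposite≢ b (proj₁ w₀) (cong proj₁ rw₀≡))
...   | w , w∈ , w≢u , w≢v =
  <-irrefl refl (<-≤-trans (missing-colour⇒degree< proper w i i-missing) (All.lookup maximal w∈))
  where
  Δ≤deg-w₀ = ≤-reflexive (sym deg-w₀≡Δ)
  maximal : All (λ w → Δ (2 * a) (2 * b) ≤ degree w) (w₀ ∷ reflectˣ w₀ ∷ reflectʸ w₀ ∷ [])
  maximal = Δ≤deg-w₀
          ∷ ≤-trans Δ≤deg-w₀ (degree-mono reflectˣ reflectˣ-injective reflectˣ-adj w₀)
          ∷ ≤-trans Δ≤deg-w₀ (degree-mono reflectʸ reflectʸ-injective reflectʸ-adj w₀)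
          ∷ []
  i-missing : ∀ x → Adj w x → c w x ≢ i
  i-missing x wx cwx≡i with only-uv w x wx cwx≡i
  ... | inj₁ (w≡u , _) = w≢u w≡u
  ... | inj₂ (w≡v , _) = w≢v w≡v

-- The 2 × 2 board

1≤∣-∣⇒opposite : (a b : Fin 2) → 1 ≤ ∣ toℕ a - toℕ b ∣ → b ≡ opposite a
1≤∣-∣⇒opposite fzero fzero ()
1≤∣-∣⇒opposite fzero (fsuc fzero) _ = refl
1≤∣-∣⇒opposite (fsuc fzero) fzero _ = refl
1≤∣-∣⇒opposite (fsuc fzero) (fsuc fzero) ()

adj⇒opposite-corner : (u v : Square 2 2) → Adj u v → v ≡ reflectˣ (reflectʸ u)
adj⇒opposite-corner (x , y) (x' , y') (dx≡dy , 1≤dx) =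
  cong₂ _,_ (1≤∣-∣⇒opposite x x' 1≤dx) (1≤∣-∣⇒opposite y y' (subst (1 ≤_) dx≡dy 1≤dx))

colour-on-exactly-two-edges-2×2 :
  Σ[ C ∈ ProperEdgeColoring 2 2 (Δ 2 2) ] ∃[ i ] ColorOnExactlyTwoEdges (proj₁ C) i
colour-on-exactly-two-edges-2×2 =
  ((λ _ _ → fzero) , (λ _ _ _ → refl) , proper) , fzero ,
  (fzero , fzero) , (fsuc fzero , fsuc fzero) , (fzero , fsuc fzero) , (fsuc fzero , fzero) ,
  ((refl , s≤s z≤n) , refl , (refl , s≤s z≤n) , refl , distinct , diagonals)
  where
  proper : IsProper {2} {2} {Δ 2 2} (λ _ _ → fzero)
  proper u v w uv uw v≢w _ = v≢w (trans (adj⇒opposite-corner u v uv) (sym (adj⇒opposite-corner u w uw)))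
  distinct : ¬ SameEdge {2} {2} (fzero , fzero) (fsuc fzero , fsuc fzero) (fzero , fsuc fzero) (fsuc fzero , fzero)
  distinct (inj₁ (() , _))
  distinct (inj₂ (() , _))
  diagonals : ∀ a b → Adj a b → fzero ≡ fzero →
    SameEdge a b (fzero , fzero) (fsuc fzero , fsuc fzero) ⊎ SameEdge a b (fzero , fsuc fzero) (fsuc fzero , fzero)
  diagonals a b ab _ rewrite adj⇒opposite-corner a b ab with a
  ... | fzero , fzero = inj₁ (inj₁ (refl , refl))
  ... | fzero , fsuc fzero = inj₂ (inj₁ (refl , refl))
  ... | fsuc fzero , fzero = inj₂ (inj₂ (refl , refl))
  ... | fsuc fzero , fsuc fzero = inj₁ (inj₂ (refl , refl))

-- Colourings of complete graphs

module _ (L : ℕ) .{{_ : NonZero L}} where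

  %-split : ∀ {s} → s < L + L → s < L × s % L ≡ s ⊎ L ≤ s × s % L + L ≡ s
  %-split {s} s<2L with s <? L
  ... | yes s<L = inj₁ (s<L , m<n⇒m%n≡m s<L)
  ... | no s≮L = inj₂ (L≤s , (begin
    s % L + L       ≡⟨ cong (_+ L) (m≤n⇒[n∸m]%m≡n%m L≤s) ⟨
    (s ∸ L) % L + L ≡⟨ cong (_+ L) (m<n⇒m%n≡m s∸L<L) ⟩
    s ∸ L + L       ≡⟨ m∸n+n≡m L≤s ⟩
    s               ∎))
    where
    open ≡-Reasoning
    L≤s = ≮⇒≥ s≮L
    s∸L<L : s ∸ L < L
    s∸L<L = +-cancelʳ-< L (s ∸ L) L (subst (_< L + L) (sym (m∸n+n≡m L≤s)) s<2L)

  %-≡-cases : ∀ {s t} → s < L + L → t < L + L → s % L ≡ t % L → s ≡ t ⊎ s + L ≡ t ⊎ s ≡ t + L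
  %-≡-cases s<2L t<2L s%≡t% with %-split s<2L | %-split t<2L
  ... | inj₁ (_ , s%≡s) | inj₁ (_ , t%≡t) = inj₁ (trans (sym s%≡s) (trans s%≡t% t%≡t))
  ... | inj₂ (_ , s%+L≡s) | inj₂ (_ , t%+L≡t) = inj₁ (trans (sym s%+L≡s) (trans (cong (_+ L) s%≡t%) t%+L≡t))
  ... | inj₁ (_ , s%≡s) | inj₂ (_ , t%+L≡t) = inj₂ (inj₁ (trans (cong (_+ L) (trans (sym s%≡s) s%≡t%)) t%+L≡t))
  ... | inj₂ (_ , s%+L≡s) | inj₁ (_ , t%≡t) = inj₂ (inj₂ (trans (sym s%+L≡s) (cong (_+ L) (trans s%≡t% t%≡t))))

  +L≢ : ∀ {a b} → b < L → a + L ≢ b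
  +L≢ {a} b<L a+L≡b = <⇒≱ b<L (subst (L ≤_) a+L≡b (m≤n+m L a))

  [i+a]%L-injective : ∀ {i a b} → i < L → a < L → b < L → (i + a) % L ≡ (i + b) % L → a ≡ b
  [i+a]%L-injective {i} {a} {b} i<L a<L b<L eq with %-≡-cases (+-mono-< i<L a<L) (+-mono-< i<L b<L) eq
  ... | inj₁ i+a≡i+b          = +-cancelˡ-≡ i a b i+a≡i+b
  ... | inj₂ (inj₁ i+a+L≡i+b) = ⊥-elim (+L≢ b<L (+-cancelˡ-≡ i _ _ (trans (sym (+-assoc i a L)) i+a+L≡i+b)))
  ... | inj₂ (inj₂ i+a≡i+b+L) =
    ⊥-elim (+L≢ a<L (+-cancelˡ-≡ i _ _ (trans (sym (+-assoc i b L)) (sym i+a≡i+b+L))))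

  m+m+L≢n+n : parity L ≡ 1ℙ → ∀ m n → m + m + L ≢ n + n
  m+m+L≢n+n L-odd m n eq with begin
    0ℙ                           ≡⟨ parity[n+n]≡0ℙ n ⟨
    parity (n + n)               ≡⟨ cong parity eq ⟨
    parity (m + m + L)           ≡⟨ Parity.+-homo-+ (m + m) L ⟩
    parity (m + m) ℙ.+ parity L  ≡⟨ cong₂ ℙ._+_ (parity[n+n]≡0ℙ m) L-odd ⟩
    1ℙ                           ∎
    where open ≡-Reasoning
  ... | ()

  [a+a]%L-injective : parity L ≡ 1ℙ → ∀ {a b} → a < L → b < L → (a + a) % L ≡ (b + b) % L → a ≡ b
  [a+a]%L-injective L-odd {a} {b} a<L b<L eq with %-≡-cases (+-mono-< a<L a<L) (+-mono-< b<L b<L) eq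
  ... | inj₁ a+a≡b+b = double-injective a b a+a≡b+b
  ... | inj₂ (inj₁ a+a+L≡b+b) = ⊥-elim (m+m+L≢n+n L-odd a b a+a+L≡b+b)
  ... | inj₂ (inj₂ a+a≡b+b+L) = ⊥-elim (m+m+L≢n+n L-odd b a (sym a+a≡b+b+L))

  -- A 1-factorisation of the complete graph on {0, …, L} for odd L: class t of the colouring
  -- (i + a) % L of {0, …, L - 1} misses exactly the vertex p with (p + p) % L ≡ t, which is matched to L.
  oneFactor : ℕ → ℕ → ℕ
  oneFactor i a with i ≟ L | a ≟ L
  ... | yes _ | _     = (a + a) % L
  ... | no _  | yes _ = (i + i) % L
  ... | no _  | no _  = (i + a) % L

  oneFactor-< : ∀ i a → oneFactor i a < L
  oneFactor-< i a with i ≟ L | a ≟ L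
  ... | yes _ | _     = m%n<n (a + a) L
  ... | no _  | yes _ = m%n<n (i + i) L
  ... | no _  | no _  = m%n<n (i + a) L

  oneFactor-comm : ∀ i a → oneFactor i a ≡ oneFactor a i
  oneFactor-comm i a with i ≟ L | a ≟ L
  ... | yes refl | yes refl = refl
  ... | yes _    | no _     = refl
  ... | no _     | yes _    = refl
  ... | no _     | no _     = cong (_% L) (+-comm i a)

  oneFactor≡ : ∀ {i a} → i ≢ L → a ≢ L → oneFactor i a ≡ (i + a) % L
  oneFactor≡ {i} {a} i≢L a≢L with i ≟ L | a ≟ L
  ... | yes i≡L | _       = ⊥-elim (i≢L i≡L)
  ... | no _    | yes a≡L = ⊥-elim (a≢L a≡L)
  ... | no _    | no _    = refl

  oneFactor-injective : parity L ≡ 1ℙ → ∀ {i a b} → i ≤ L → a ≤ L → b ≤ L → i ≢ a → i ≢ b → a ≢ b →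
    oneFactor i a ≢ oneFactor i b
  oneFactor-injective L-odd {i} {a} {b} i≤L a≤L b≤L i≢a i≢b a≢b eq with i ≟ L | a ≟ L | b ≟ L
  ... | yes refl | _        | _        =
    a≢b ([a+a]%L-injective L-odd (≤∧≢⇒< a≤L (≢-sym i≢a)) (≤∧≢⇒< b≤L (≢-sym i≢b)) eq)
  ... | no _     | yes refl | yes refl = a≢b refl
  ... | no i≢L   | yes refl | no b≢L   = i≢b ([i+a]%L-injective i<L i<L (≤∧≢⇒< b≤L b≢L) eq)
    where i<L = ≤∧≢⇒< i≤L i≢L
  ... | no i≢L   | no a≢L   | yes refl = i≢a (sym ([i+a]%L-injective i<L (≤∧≢⇒< a≤L a≢L) i<L eq))
    where i<L = ≤∧≢⇒< i≤L i≢L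
  ... | no i≢L   | no a≢L   | no b≢L   = a≢b ([i+a]%L-injective (≤∧≢⇒< i≤L i≢L) (≤∧≢⇒< a≤L a≢L) (≤∧≢⇒< b≤L b≢L) eq)

-- Diagonals of ℕ × ℕ

Point : Set
Point = ℕ × ℕ

Adjℕ : Point → Point → Set
Adjℕ (x , y) (x' , y') = (∣ x - x' ∣ ≡ ∣ y - y' ∣) × (1 ≤ ∣ x - x' ∣)

data SameDiagonal : Point → Point → Set where
  same-diagonal : ∀ {x y x' y'} → x + y' ≡ x' + y → SameDiagonal (x , y) (x' , y')

sameDiagonal? : ∀ u v → Dec (SameDiagonal u v)
sameDiagonal? (x , y) (x' , y') = map′ same-diagonal (λ { (same-diagonal eq) → eq }) (x + y' ≟ x' + y)

SameDiagonal-sym : ∀ {u v} → SameDiagonal u v → SameDiagonal v u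
SameDiagonal-sym (same-diagonal eq) = same-diagonal (sym eq)

-- A point u lies on the diagonal at distance offset u from the main diagonal, at index position u along it.
offset position : Point → ℕ
offset (x , y) = ∣ x - y ∣
position (x , y) = x ⊓ y

reflect : ℕ → Point → Point
reflect L (x , y) = x , L ∸ y

SameDiagonal-trans : ∀ {u v w} → SameDiagonal u v → SameDiagonal u w → SameDiagonal v w
SameDiagonal-trans {x , y} {x₁ , y₁} {x₂ , y₂} (same-diagonal uv) (same-diagonal uw) =
  same-diagonal (+-cancelʳ-≡ (x + y) _ _ (begin
  (x₁ + y₂) + (x + y) ≡⟨ regroup x₁ y₂ x y ⟩
  (x + y₂) + (x₁ + y) ≡⟨ cong₂ _+_ uw (sym uv) ⟩
  (x₂ + y) + (x + y₁) ≡⟨ +-comm (x₂ + y) (x + y₁) ⟩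
  (x + y₁) + (x₂ + y) ≡⟨ regroup x₂ y₁ x y ⟨
  (x₂ + y₁) + (x + y) ∎))
  where
  open ≡-Reasoning
  regroup : ∀ a b c d → (a + b) + (c + d) ≡ (c + b) + (a + d)
  regroup = solve-∀

position+offset≡⊔ : ∀ u → position u + offset u ≡ proj₁ u ⊔ proj₂ u
position+offset≡⊔ (x , y) with ≤-total x y
... | inj₁ x≤y = begin
  x ⊓ y + ∣ x - y ∣ ≡⟨ cong₂ _+_ (m≤n⇒m⊓n≡m x≤y) (m≤n⇒∣m-n∣≡n∸m x≤y) ⟩
  x + (y ∸ x)       ≡⟨ m+[n∸m]≡n x≤y ⟩
  y                 ≡⟨ m≤n⇒m⊔n≡n x≤y ⟨
  x ⊔ y             ∎
  where open ≡-Reasoning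
... | inj₂ y≤x = begin
  x ⊓ y + ∣ x - y ∣ ≡⟨ cong₂ _+_ (m≥n⇒m⊓n≡n y≤x) (m≤n⇒∣n-m∣≡n∸m y≤x) ⟩
  y + (x ∸ y)       ≡⟨ m+[n∸m]≡n y≤x ⟩
  x                 ≡⟨ m≥n⇒m⊔n≡m y≤x ⟨
  x ⊔ y             ∎
  where open ≡-Reasoning

SameDiagonal-shift : ∀ {x y x' y'} → x + y' ≡ x' + y → x ≤ x' → ∃[ s ] x' ≡ x + s × y' ≡ y + s
SameDiagonal-shift {x} {y} {x'} {y'} eq x≤x' = x' ∸ x , sym (m+[n∸m]≡n x≤x') , +-cancelˡ-≡ x _ _ (begin
  x + y'             ≡⟨ eq ⟩
  x' + y             ≡⟨ cong (_+ y) (m+[n∸m]≡n x≤x') ⟨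
  x + (x' ∸ x) + y   ≡⟨ +-assoc x _ y ⟩
  x + (x' ∸ x + y)   ≡⟨ cong (x +_) (+-comm _ y) ⟩
  x + (y + (x' ∸ x)) ∎)
  where open ≡-Reasoning

SameDiagonal-position-injective : ∀ {u v} → SameDiagonal u v → position u ≡ position v → u ≡ v
SameDiagonal-position-injective {x , y} {x' , y'} (same-diagonal eq) ⊓≡ =
  cong₂ _,_ x≡x' (sym (+-cancelˡ-≡ x y' y (trans eq (cong (_+ y) (sym x≡x')))))
  where
  ≤-case : ∀ {x y x' y'} → x + y' ≡ x' + y → x ≤ x' → x ⊓ y ≡ x' ⊓ y' → x ≡ x'
  ≤-case {x} {y} eq x≤x' ⊓≡ with SameDiagonal-shift eq x≤x'
  ... | s , refl , refl = trans (sym (+-identityʳ x)) (cong (x +_) (sym s≡0))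
    where
    s≡0 : s ≡ 0
    s≡0 = +-cancelˡ-≡ (x ⊓ y) s 0
      (trans (sym (trans ⊓≡ (sym (+-distribʳ-⊓ s x y)))) (sym (+-identityʳ (x ⊓ y))))
  x≡x' : x ≡ x'
  x≡x' with ≤-total x x'
  ... | inj₁ x≤x' = ≤-case eq x≤x' ⊓≡
  ... | inj₂ x'≤x = sym (≤-case (sym eq) x'≤x (sym ⊓≡))

SameDiagonal⇒offset≡ : ∀ {u v} → SameDiagonal u v → offset u ≡ offset v
SameDiagonal⇒offset≡ {x , y} {x' , y'} (same-diagonal eq) = begin
  ∣ x - y ∣             ≡⟨ ∣m+n-m+o∣≡∣n-o∣ y' x y ⟨
  ∣ y' + x - y' + y ∣   ≡⟨ cong₂ ∣_-_∣ (trans (+-comm y' x) eq) (+-comm y' y) ⟩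
  ∣ x' + y - y + y' ∣   ≡⟨ cong (∣_- y + y' ∣) (+-comm x' y) ⟩
  ∣ y + x' - y + y' ∣   ≡⟨ ∣m+n-m+o∣≡∣n-o∣ y x' y' ⟩
  ∣ x' - y' ∣           ∎
  where open ≡-Reasoning

offset≡0 : ∀ {u} → offset u ≡ 0 → u ≡ (position u , position u)
offset≡0 {x , y} ∣x-y∣≡0 with ∣m-n∣≡0⇒m≡n {x} {y} ∣x-y∣≡0
... | refl = sym (cong₂ _,_ (⊓-idem x) (⊓-idem x))

∣-∣≡∣-∣⇒diagonal⊎antidiagonal : ∀ {x y x' y'} → ∣ x - x' ∣ ≡ ∣ y - y' ∣ → x + y' ≡ x' + y ⊎ x + y ≡ x' + y'
∣-∣≡∣-∣⇒diagonal⊎antidiagonal {x} {y} {x'} {y'} dx≡dy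
  with ∣-∣-view x x' | subst (λ d → y + d ≡ y' ⊎ y' + d ≡ y) (sym dx≡dy) (∣-∣-view y y')
... | inj₁ x+d≡x' | inj₁ y+d≡y' = inj₁ (+-translate x+d≡x' y+d≡y')
... | inj₁ x+d≡x' | inj₂ y'+d≡y = inj₂ (+-translate x+d≡x' y'+d≡y)
... | inj₂ x'+d≡x | inj₁ y+d≡y' = inj₂ (sym (+-translate x'+d≡x y+d≡y'))
... | inj₂ x'+d≡x | inj₂ y'+d≡y = inj₁ (sym (+-translate x'+d≡x y'+d≡y))

antidiagonal-reflect : ∀ L {x y x' y'} → y ≤ L → y' ≤ L → x + y ≡ x' + y' →
  SameDiagonal (reflect L (x , y)) (reflect L (x' , y'))
antidiagonal-reflect L {x} {y} {x'} {y'} y≤L y'≤L eq = same-diagonal (+-cancelʳ-≡ (y + y') _ _ (begin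
  (x + (L ∸ y')) + (y + y')  ≡⟨ regroup x (L ∸ y') y y' ⟩
  (x + y) + ((L ∸ y') + y')  ≡⟨ cong₂ _+_ eq (m∸n+n≡m y'≤L) ⟩
  (x' + y') + L              ≡⟨ cong ((x' + y') +_) (m∸n+n≡m y≤L) ⟨
  (x' + y') + ((L ∸ y) + y)  ≡⟨ regroup′ x' (L ∸ y) y y' ⟨
  (x' + (L ∸ y)) + (y + y')  ∎))
  where
  open ≡-Reasoning
  regroup : ∀ a r b c → (a + r) + (b + c) ≡ (a + b) + (r + c)
  regroup = solve-∀
  regroup′ : ∀ a r b c → (a + r) + (b + c) ≡ (a + c) + (r + b)
  regroup′ = solve-∀

parity-offset-reflect : ∀ L {x y} → y ≤ L →
  parity (offset (x , y)) ℙ.+ parity (offset (reflect L (x , y))) ≡ parity L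
parity-offset-reflect L {x} {y} y≤L = begin
  parity ∣ x - y ∣ ℙ.+ parity ∣ x - (L ∸ y) ∣ ≡⟨ cong₂ ℙ._+_ (parity-∣-∣ x y) (parity-∣-∣ x (L ∸ y)) ⟩
  parity (x + y) ℙ.+ parity (x + (L ∸ y))     ≡⟨ Parity.+-homo-+ (x + y) _ ⟨
  parity ((x + y) + (x + (L ∸ y)))            ≡⟨ cong parity (regroup x y (L ∸ y)) ⟩
  parity ((x + x) + (y + (L ∸ y)))            ≡⟨ cong (λ z → parity ((x + x) + z)) (m+[n∸m]≡n y≤L) ⟩
  parity ((x + x) + L)                        ≡⟨ parity[n+n+d]≡parity[d] x L ⟩
  parity L                                    ∎
  where
  open ≡-Reasoning
  regroup : ∀ x y z → (x + y) + (x + z) ≡ (x + x) + (y + z)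
  regroup = solve-∀

-- The colouring of B_{2k,2k} for k ≥ 2

-- The board has side n = 2k with k = j + 2; c₀ = k - 1 and c₁ = k are the central coordinates,
-- L = 2k - 1, L₂ = 2k - 3, and M = 4k - 3 is the maximum degree.
module Construction (j : ℕ) where

  c₀ c₁ L₂ L n M : ℕ
  c₀ = suc j
  c₁ = suc c₀
  L₂ = suc (j + j)
  L  = suc (suc L₂)
  n  = suc L
  M  = n + L₂

  L-odd : parity L ≡ 1ℙ
  L-odd = parity[1+n+n]≡1ℙ j

  L₂-odd : parity L₂ ≡ 1ℙ
  L₂-odd = parity[1+n+n]≡1ℙ j

  c₀+c₀≡L∸1 : c₀ + c₀ ≡ suc L₂
  c₀+c₀≡L∸1 = cong suc (+-suc j j)

  c₀+c₀<L : c₀ + c₀ < L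
  c₀+c₀<L = ≤-reflexive (cong suc c₀+c₀≡L∸1)

  c₀+c₁≡L : c₀ + c₁ ≡ L
  c₀+c₁≡L = cong suc (trans (+-suc j (suc j)) (cong suc (+-suc j j)))

  c₀<L : c₀ < L
  c₀<L = subst (c₀ <_) c₀+c₁≡L (m<m+n c₀ z<s)

  c₁<L : c₁ < L
  c₁<L = subst (c₁ <_) c₀+c₁≡L (m<n+m c₁ z<s)

  c₀≢c₁ : c₀ ≢ c₁
  c₀≢c₁ c₀≡c₁ = 1+n≢n (sym c₀≡c₁)

  CentrePair : ℕ → ℕ → Set
  CentrePair i a = i ≡ c₀ × a ≡ c₁ ⊎ i ≡ c₁ × a ≡ c₀

  centrePair? : ∀ i a → Dec (CentrePair i a)
  centrePair? i a = (i ≟ c₀ ×-dec a ≟ c₁) ⊎-dec (i ≟ c₁ ×-dec a ≟ c₀)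

  CentrePair-sym : ∀ {i a} → CentrePair i a → CentrePair a i
  CentrePair-sym (inj₁ (i≡c₀ , a≡c₁)) = inj₂ (a≡c₁ , i≡c₀)
  CentrePair-sym (inj₂ (i≡c₁ , a≡c₀)) = inj₁ (a≡c₀ , i≡c₁)

  CentrePair-functional : ∀ {i a b} → CentrePair i a → CentrePair i b → a ≡ b
  CentrePair-functional (inj₁ (_ , a≡c₁)) (inj₁ (_ , b≡c₁)) = trans a≡c₁ (sym b≡c₁)
  CentrePair-functional (inj₂ (_ , a≡c₀)) (inj₂ (_ , b≡c₀)) = trans a≡c₀ (sym b≡c₀)
  CentrePair-functional (inj₁ (i≡c₀ , _)) (inj₂ (i≡c₁ , _)) = ⊥-elim (c₀≢c₁ (trans (sym i≡c₀) i≡c₁))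
  CentrePair-functional (inj₂ (i≡c₁ , _)) (inj₁ (i≡c₀ , _)) = ⊥-elim (c₀≢c₁ (trans (sym i≡c₀) i≡c₁))

  CentrePair-≤L : ∀ {i a} → CentrePair i a → i ≤ L × a ≤ L
  CentrePair-≤L (inj₁ (refl , refl)) = <⇒≤ c₀<L , <⇒≤ c₁<L
  CentrePair-≤L (inj₂ (refl , refl)) = <⇒≤ c₁<L , <⇒≤ c₀<L

  CentrePair-≢ : ∀ {i a} → CentrePair i a → i ≢ a
  CentrePair-≢ (inj₁ (refl , refl)) = c₀≢c₁
  CentrePair-≢ (inj₂ (refl , refl)) = ≢-sym c₀≢c₁

  oneFactor-centre : ∀ {i a} → CentrePair i a → oneFactor L i a ≡ 0
  oneFactor-centre (inj₁ (refl , refl)) = begin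
    oneFactor L c₀ c₁ ≡⟨ oneFactor≡ L (<⇒≢ c₀<L) (<⇒≢ c₁<L) ⟩
    (c₀ + c₁) % L     ≡⟨ cong (_% L) c₀+c₁≡L ⟩
    L % L             ≡⟨ n%n≡0 L ⟩
    0                 ∎
    where open ≡-Reasoning
  oneFactor-centre (inj₂ (refl , refl)) = trans (oneFactor-comm L c₁ c₀) (oneFactor-centre (inj₁ (refl , refl)))

  centreLineColour : ℕ → ℕ → ℕ
  centreLineColour i a with centrePair? i a
  ... | yes _ = 0
  ... | no _  = suc (oneFactor L i a)

  centreLineColour-centre : ∀ {i a} → CentrePair i a → centreLineColour i a ≡ 0
  centreLineColour-centre {i} {a} cp with centrePair? i a
  ... | yes _  = refl
  ... | no ¬cp = ⊥-elim (¬cp cp)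

  centreLineColour-≤L : ∀ i a → centreLineColour i a ≤ L
  centreLineColour-≤L i a with centrePair? i a
  ... | yes _ = z≤n
  ... | no _  = oneFactor-< L i a

  centreLineColour-comm : ∀ i a → centreLineColour i a ≡ centreLineColour a i
  centreLineColour-comm i a with centrePair? i a | centrePair? a i
  ... | yes _  | yes _  = refl
  ... | yes cp | no ¬cp = ⊥-elim (¬cp (CentrePair-sym cp))
  ... | no ¬cp | yes cp = ⊥-elim (¬cp (CentrePair-sym cp))
  ... | no _   | no _   = cong suc (oneFactor-comm L i a)

  centreLineColour-injective : ∀ {i a b} → i ≤ L → a ≤ L → b ≤ L → i ≢ a → i ≢ b → a ≢ b →
    centreLineColour i a ≢ centreLineColour i b
  centreLineColour-injective {i} {a} {b} i≤L a≤L b≤L i≢a i≢b a≢b with centrePair? i a | centrePair? i b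
  ... | yes cpa | yes cpb = λ _ → a≢b (CentrePair-functional cpa cpb)
  ... | yes _   | no _    = λ ()
  ... | no _    | yes _   = λ ()
  ... | no _    | no _    = λ eq → oneFactor-injective L L-odd i≤L a≤L b≤L i≢a i≢b a≢b (suc-injective eq)

  centre-partner : ∀ {i} → i ≡ c₀ ⊎ i ≡ c₁ → ∃[ p ] CentrePair i p
  centre-partner (inj₁ i≡c₀) = c₁ , inj₁ (i≡c₀ , refl)
  centre-partner (inj₂ i≡c₁) = c₀ , inj₂ (i≡c₁ , refl)

  -- Colour 1 is the rest of class 0 of oneFactor L, whose edge c₀c₁ was given colour 0.
  centreLineColour-≢1 : ∀ {i a} → (i ≡ c₀ ⊎ i ≡ c₁) → a ≤ L → i ≢ a → centreLineColour i a ≢ 1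
  centreLineColour-≢1 {i} {a} i-central a≤L i≢a with centrePair? i a | centre-partner i-central
  ... | yes _  | _      = λ ()
  ... | no ¬cp | p , cp = λ eq →
    oneFactor-injective L L-odd (proj₁ (CentrePair-≤L cp)) a≤L (proj₂ (CentrePair-≤L cp)) i≢a (CentrePair-≢ cp)
      (λ a≡p → ¬cp (subst (CentrePair i) (sym a≡p) cp)) (trans (suc-injective eq) (sym (oneFactor-centre cp)))

  -- Class L - 1 = c₀ + c₀ of the colouring (i + a) % L misses the position c₀, where the lines at
  -- distance 1 meet the longest ones, so it can share colour 2 with them (lineColour-disjoint).
  relabel : ℕ → ℕ
  relabel t with t ≟ 0 | t ≟ suc L₂
  ... | yes _ | _     = 1
  ... | no _  | yes _ = 2
  ... | no _  | no _  = L + t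

  relabel-cases : ∀ t → t ≡ 0 × relabel t ≡ 1 ⊎ t ≡ suc L₂ × relabel t ≡ 2 ⊎ t ≢ 0 × t ≢ suc L₂ × relabel t ≡ L + t
  relabel-cases t with t ≟ 0 | t ≟ suc L₂
  ... | yes t≡0 | _          = inj₁ (t≡0 , refl)
  ... | no _    | yes t≡L-1  = inj₂ (inj₁ (t≡L-1 , refl))
  ... | no t≢0  | no t≢L-1   = inj₂ (inj₂ (t≢0 , t≢L-1 , refl))

  relabel-injective : ∀ t t' → relabel t ≡ relabel t' → t ≡ t'
  relabel-injective t t' eq with relabel-cases t | relabel-cases t'
  ... | inj₁ (refl , _)                | inj₁ (refl , _)                = refl
  ... | inj₂ (inj₁ (refl , _))         | inj₂ (inj₁ (refl , _))         = refl
  ... | inj₂ (inj₂ (_ , _ , r≡))       | inj₂ (inj₂ (_ , _ , r'≡))      =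
    +-cancelˡ-≡ L t t' (trans (sym r≡) (trans eq r'≡))
  ... | inj₁ (_ , r≡)                  | inj₂ (inj₁ (_ , r'≡))          with () ← trans (sym r≡) (trans eq r'≡)
  ... | inj₁ (_ , r≡)                  | inj₂ (inj₂ (_ , _ , r'≡))      with () ← trans (sym r≡) (trans eq r'≡)
  ... | inj₂ (inj₁ (_ , r≡))           | inj₁ (_ , r'≡)                 with () ← trans (sym r≡) (trans eq r'≡)
  ... | inj₂ (inj₁ (_ , r≡))           | inj₂ (inj₂ (_ , _ , r'≡))      with () ← trans (sym r≡) (trans eq r'≡)
  ... | inj₂ (inj₂ (_ , _ , r≡))       | inj₁ (_ , r'≡)                 with () ← trans (sym r≡) (trans eq r'≡)
  ... | inj₂ (inj₂ (_ , _ , r≡))       | inj₂ (inj₁ (_ , r'≡))          with () ← trans (sym r≡) (trans eq r'≡)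

  relabel-palette : ∀ t → relabel t ≡ 1 ⊎ relabel t ≡ 2 ⊎ n ≤ relabel t
  relabel-palette t with relabel-cases t
  ... | inj₁ (_ , r≡1)                = inj₁ r≡1
  ... | inj₂ (inj₁ (_ , r≡2))         = inj₂ (inj₁ r≡2)
  ... | inj₂ (inj₂ (t≢0 , _ , r≡L+t)) =
    inj₂ (inj₂ (subst (n ≤_) (sym r≡L+t) (subst (_≤ L + t) (+-comm L 1) (+-monoʳ-≤ L (n≢0⇒n>0 t≢0)))))

  relabel≡2 : ∀ {t} → relabel t ≡ 2 → t ≡ suc L₂
  relabel≡2 {t} r≡2 with relabel-cases t
  ... | inj₁ (_ , r≡1)              with () ← trans (sym r≡1) r≡2
  ... | inj₂ (inj₁ (t≡L-1 , _))     = t≡L-1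
  ... | inj₂ (inj₂ (_ , _ , r≡L+t)) with () ← trans (sym r≡L+t) r≡2

  relabel-< : ∀ {t} → t < L → relabel t < M
  relabel-< {t} t<L with relabel-cases t
  ... | inj₁ (_ , r≡1)               = subst (_< M) (sym r≡1) (s≤s (s≤s z≤n))
  ... | inj₂ (inj₁ (_ , r≡2))        = subst (_< M) (sym r≡2) (s≤s (s≤s (s≤s z≤n)))
  ... | inj₂ (inj₂ (_ , t≢L-1 , r≡)) = subst (_< M) (sym r≡) (s≤s (+-monoʳ-≤ L (≤-pred (≤∧≢⇒< (≤-pred t<L) t≢L-1))))

  -- lineColour r colours the complete graph on the positions 0, …, n - r - 1 of a diagonal at distance r
  -- from the main one. Even distances use the colours 0, …, L and odd distances the colours 1, 2 and
  -- n, …, M - 1; the lines at distance 0 and 1 cross only at the central squares, where colours 1 and 2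
  -- are arranged not to clash (lineColour-disjoint).
  lineColour : ℕ → ℕ → ℕ → ℕ
  lineColour 0 i a = centreLineColour i a
  lineColour 1 i a = relabel ((i + a) % L)
  lineColour 2 i a = 3 + oneFactor L₂ i a
  lineColour 3 i a = n + (i + a) % L₂
  lineColour (suc (suc (suc (suc r)))) i a = lineColour (suc (suc r)) i a

  shorter : ∀ {i r} → i + suc (suc r) < n → i + r < n
  shorter {i} {r} = ≤-<-trans (+-monoʳ-≤ i (m≤n+m r 2))

  lineColour-comm : ∀ r i a → lineColour r i a ≡ lineColour r a i
  lineColour-comm 0 i a = centreLineColour-comm i a
  lineColour-comm 1 i a = cong (λ s → relabel (s % L)) (+-comm i a)
  lineColour-comm 2 i a = cong (3 +_) (oneFactor-comm L₂ i a)
  lineColour-comm 3 i a = cong (λ s → n + s % L₂) (+-comm i a)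
  lineColour-comm (suc (suc (suc (suc r)))) i a = lineColour-comm (suc (suc r)) i a

  lineColour-injective : ∀ r {i a b} → i + r < n → a + r < n → b + r < n → i ≢ a → i ≢ b → a ≢ b →
    lineColour r i a ≢ lineColour r i b
  lineColour-injective 0 i+0<n a+0<n b+0<n i≢a i≢b a≢b =
    centreLineColour-injective (≤-pred (position< 0 i+0<n)) (≤-pred (position< 0 a+0<n)) (≤-pred (position< 0 b+0<n))
      i≢a i≢b a≢b
  lineColour-injective 1 i+1<n a+1<n b+1<n _ _ a≢b eq =
    a≢b ([i+a]%L-injective L (position< 1 i+1<n) (position< 1 a+1<n) (position< 1 b+1<n) (relabel-injective _ _ eq))
  lineColour-injective 2 i+2<n a+2<n b+2<n i≢a i≢b a≢b eq =
    oneFactor-injective L₂ L₂-odd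
      (≤-pred (position< 2 i+2<n)) (≤-pred (position< 2 a+2<n)) (≤-pred (position< 2 b+2<n))
      i≢a i≢b a≢b (+-cancelˡ-≡ 3 _ _ eq)
  lineColour-injective 3 i+3<n a+3<n b+3<n _ _ a≢b eq =
    a≢b ([i+a]%L-injective L₂ (position< 3 i+3<n) (position< 3 a+3<n) (position< 3 b+3<n) (+-cancelˡ-≡ n _ _ eq))
  lineColour-injective (suc (suc (suc (suc r)))) i+r<n a+r<n b+r<n =
    lineColour-injective (suc (suc r)) (shorter i+r<n) (shorter a+r<n) (shorter b+r<n)

  lineColour-< : ∀ r i a → lineColour r i a < M
  lineColour-< 0 i a = s≤s (≤-trans (centreLineColour-≤L i a) (m≤m+n L L₂))
  lineColour-< 1 i a = relabel-< (m%n<n (i + a) L)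
  lineColour-< 2 i a = ≤-trans (+-monoʳ-< 3 (oneFactor-< L₂ i a)) (+-monoˡ-≤ L₂ {3} {n} (s≤s (s≤s (s≤s z≤n))))
  lineColour-< 3 i a = +-monoʳ-< n (m%n<n (i + a) L₂)
  lineColour-< (suc (suc (suc (suc r)))) i a = lineColour-< (suc (suc r)) i a

  lineColour≡0 : ∀ r i a → lineColour r i a ≡ 0 → r ≡ 0 × CentrePair i a
  lineColour≡0 0 i a c≡0 with centrePair? i a
  ... | yes cp = refl , cp
  lineColour≡0 1 i a c≡0 with relabel-palette ((i + a) % L)
  ... | inj₁ r≡1        with () ← trans (sym r≡1) c≡0
  ... | inj₂ (inj₁ r≡2) with () ← trans (sym r≡2) c≡0
  ... | inj₂ (inj₂ n≤r) with () ← subst (n ≤_) c≡0 n≤r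
  lineColour≡0 (suc (suc (suc (suc r)))) i a c≡0 with () ← proj₁ (lineColour≡0 (suc (suc r)) i a c≡0)

  evenLine-≤L : ∀ r {i a} → parity r ≡ 0ℙ → lineColour r i a ≤ L
  evenLine-≤L 0 {i} {a} _ = centreLineColour-≤L i a
  evenLine-≤L 2 {i} {a} _ = s≤s (s≤s (oneFactor-< L₂ i a))
  evenLine-≤L (suc (suc (suc (suc r)))) even = evenLine-≤L (suc (suc r)) even

  evenLine-3≤ : ∀ r {i a} → parity r ≡ 0ℙ → 3 ≤ lineColour (suc (suc r)) i a
  evenLine-3≤ 0 _ = m≤m+n 3 _
  evenLine-3≤ (suc (suc r)) even = evenLine-3≤ r even

  oddLine-n≤ : ∀ r {i a} → parity r ≡ 1ℙ → n ≤ lineColour (suc (suc r)) i a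
  oddLine-n≤ 1 _ = m≤m+n n _
  oddLine-n≤ (suc (suc r)) odd = oddLine-n≤ r odd

  n≰L : ∀ {c} → c ≤ L → n ≤ c → ⊥
  n≰L c≤L n≤c = 1+n≰n (≤-trans n≤c c≤L)

  lineColour-disjoint : ∀ r s {i a p b} → parity r ≡ 0ℙ → parity s ≡ 1ℙ → a + r < n → i ≢ a → b + s < n → p ≢ b →
    (r ≡ 0 → s ≡ 1 → (i ≡ c₀ ⊎ i ≡ c₁) × p ≡ c₀) → lineColour r i a ≢ lineColour s p b
  lineColour-disjoint 0 1 {i} {a} {p} {b} _ _ a<n i≢a b+1<n p≢b centre eq
    with centre refl refl | relabel-palette ((p + b) % L)
  ... | i-central , _     | inj₁ r≡1 = centreLineColour-≢1 i-central (≤-pred (position< 0 a<n)) i≢a (trans eq r≡1)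
  ... | _         , refl  | inj₂ (inj₁ r≡2) =
    p≢b (sym ([i+a]%L-injective L c₀<L (position< 1 b+1<n) c₀<L
      (trans (relabel≡2 r≡2) (sym (trans (m<n⇒m%n≡m c₀+c₀<L) c₀+c₀≡L∸1)))))
  ... | _         , _     | inj₂ (inj₂ n≤r) = n≰L (evenLine-≤L 0 refl) (subst (n ≤_) (sym eq) n≤r)
  lineColour-disjoint 0 (suc (suc s)) even odd _ _ _ _ _ eq =
    n≰L (evenLine-≤L 0 even) (subst (n ≤_) (sym eq) (oddLine-n≤ s odd))
  lineColour-disjoint (suc (suc r)) 1 {p = p} {b} even _ _ _ _ _ _ eq with relabel-palette ((p + b) % L)
  ... | inj₁ r≡1        with s≤s () ← subst (3 ≤_) (trans eq r≡1) (evenLine-3≤ r even)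
  ... | inj₂ (inj₁ r≡2) with s≤s (s≤s ()) ← subst (3 ≤_) (trans eq r≡2) (evenLine-3≤ r even)
  ... | inj₂ (inj₂ n≤r) = n≰L (evenLine-≤L (suc (suc r)) even) (subst (n ≤_) (sym eq) n≤r)
  lineColour-disjoint (suc (suc r)) (suc (suc s)) even odd _ _ _ _ _ eq =
    n≰L (evenLine-≤L (suc (suc r)) even) (subst (n ≤_) (sym eq) (oddLine-n≤ s odd))

  InBoard : Point → Set
  InBoard (x , y) = x < n × y < n

  diagonalColour : Point → Point → ℕ
  diagonalColour u v = lineColour (offset u) (position u) (position v)

  edgeColour : Point → Point → ℕ
  edgeColour u v with sameDiagonal? u v
  ... | yes _ = diagonalColour u v
  ... | no _  = diagonalColour (reflect L u) (reflect L v)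

  InBoard-reflect : ∀ u → InBoard u → InBoard (reflect L u)
  InBoard-reflect (x , y) (x<n , _) = x<n , s≤s (m∸n≤m L y)

  reflect-involutive : ∀ u → InBoard u → reflect L (reflect L u) ≡ u
  reflect-involutive (x , y) (_ , y<n) = cong (x ,_) (m∸[m∸n]≡n (≤-pred y<n))

  position+offset<n : ∀ u → InBoard u → position u + offset u < n
  position+offset<n u (x<n , y<n) = subst (_< n) (sym (position+offset≡⊔ u)) (⊔-pres-<m x<n y<n)

  SameDiagonal-position<n : ∀ {u v} → InBoard v → SameDiagonal u v → position v + offset u < n
  SameDiagonal-position<n {v = v} v∈ uv =
    subst (λ r → position v + r < n) (sym (SameDiagonal⇒offset≡ uv)) (position+offset<n v v∈)

  position≢ : ∀ {u v} → SameDiagonal u v → proj₁ u ≢ proj₁ v → position u ≢ position v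
  position≢ uv x≢x' pu≡pv = x≢x' (cong proj₁ (SameDiagonal-position-injective uv pu≡pv))

  Adjℕ⇒≢ : ∀ u v → Adjℕ u v → proj₁ u ≢ proj₁ v
  Adjℕ⇒≢ (x , _) _ (_ , 1≤d) refl with () ← subst (1 ≤_) (∣n-n∣≡0 x) 1≤d

  edgeColour-diagonal : ∀ {u v} → SameDiagonal u v → edgeColour u v ≡ diagonalColour u v
  edgeColour-diagonal {u} {v} uv with sameDiagonal? u v
  ... | yes _  = refl
  ... | no ¬uv = ⊥-elim (¬uv uv)

  edgeColour-antidiagonal : ∀ {u v} → ¬ SameDiagonal u v → edgeColour u v ≡ diagonalColour (reflect L u) (reflect L v)
  edgeColour-antidiagonal {u} {v} ¬uv with sameDiagonal? u v
  ... | yes uv = ⊥-elim (¬uv uv)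
  ... | no _   = refl

  reflect-SameDiagonal : ∀ u v → InBoard u → InBoard v → Adjℕ u v → ¬ SameDiagonal u v →
    SameDiagonal (reflect L u) (reflect L v)
  reflect-SameDiagonal (x , y) (x' , y') (_ , y<n) (_ , y'<n) (dx≡dy , _) ¬uv
    with ∣-∣≡∣-∣⇒diagonal⊎antidiagonal {x} {y} {x'} {y'} dx≡dy
  ... | inj₁ uv   = ⊥-elim (¬uv (same-diagonal uv))
  ... | inj₂ anti = antidiagonal-reflect L (≤-pred y<n) (≤-pred y'<n) anti

  data EdgeView (u v : Point) : Set where
    along-diagonal : SameDiagonal u v → edgeColour u v ≡ diagonalColour u v → EdgeView u v
    along-antidiagonal : SameDiagonal (reflect L u) (reflect L v) →
      edgeColour u v ≡ diagonalColour (reflect L u) (reflect L v) → EdgeView u v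

  edgeView : ∀ u v → InBoard u → InBoard v → Adjℕ u v → EdgeView u v
  edgeView u v u∈ v∈ uv with sameDiagonal? u v
  ... | yes d  = along-diagonal d (edgeColour-diagonal d)
  ... | no ¬d  = along-antidiagonal (reflect-SameDiagonal u v u∈ v∈ uv ¬d) (edgeColour-antidiagonal ¬d)

  edgeColour-< : ∀ u v → edgeColour u v < M
  edgeColour-< u v with sameDiagonal? u v
  ... | yes _ = lineColour-< (offset u) (position u) (position v)
  ... | no _  = lineColour-< (offset (reflect L u)) (position (reflect L u)) (position (reflect L v))

  diagonalColour-comm : ∀ {u v} → SameDiagonal u v → diagonalColour u v ≡ diagonalColour v u
  diagonalColour-comm {u} {v} uv = trans (lineColour-comm (offset u) (position u) (position v))
    (cong (λ r → lineColour r (position v) (position u)) (SameDiagonal⇒offset≡ uv))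

  edgeColour-comm : ∀ u v → InBoard u → InBoard v → Adjℕ u v → edgeColour u v ≡ edgeColour v u
  edgeColour-comm u v u∈ v∈ uv = by-cases (sameDiagonal? u v)
    where
    by-cases : Dec (SameDiagonal u v) → edgeColour u v ≡ edgeColour v u
    by-cases (yes d) =
      trans (edgeColour-diagonal d) (trans (diagonalColour-comm d) (sym (edgeColour-diagonal (SameDiagonal-sym d))))
    by-cases (no ¬d) = trans (edgeColour-antidiagonal ¬d) (trans
      (diagonalColour-comm (reflect-SameDiagonal u v u∈ v∈ uv ¬d))
      (sym (edgeColour-antidiagonal (¬d ∘ SameDiagonal-sym))))

  diagonalColour-injective : ∀ {u v w} → InBoard u → InBoard v → InBoard w → SameDiagonal u v → SameDiagonal u w →
    proj₁ u ≢ proj₁ v → proj₁ u ≢ proj₁ w → v ≢ w → diagonalColour u v ≢ diagonalColour u w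
  diagonalColour-injective {u} u∈ v∈ w∈ uv uw x≢x' x≢x'' v≢w =
    lineColour-injective (offset u)
      (position+offset<n u u∈) (SameDiagonal-position<n v∈ uv) (SameDiagonal-position<n w∈ uw)
      (position≢ uv x≢x') (position≢ uw x≢x'')
      (λ pv≡pw → v≢w (SameDiagonal-position-injective (SameDiagonal-trans uv uw) pv≡pw))

  x+[1+x]≡L⇒x≡c₀ : ∀ {x} → x + suc x ≡ L → x ≡ c₀
  x+[1+x]≡L⇒x≡c₀ {x} eq =
    double-injective x c₀ (suc-injective (trans (sym (+-suc x x)) (trans eq (cong suc (sym c₀+c₀≡L∸1)))))

  +≡L⇒∣-∣≡1⇒central : ∀ {x b} → x + b ≡ L → ∣ x - b ∣ ≡ 1 → (x ≡ c₀ ⊎ x ≡ c₁) × x ⊓ b ≡ c₀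
  +≡L⇒∣-∣≡1⇒central {x} {b} x+b≡L d≡1 with ∣-∣-view x b
  ... | inj₁ x+d≡b = inj₁ x≡c₀ , trans (m≤n⇒m⊓n≡m (subst (x ≤_) x+d≡b (m≤m+n x _))) x≡c₀
    where
    x≡c₀ = x+[1+x]≡L⇒x≡c₀ (trans (cong (x +_) (trans (+-comm 1 x) (trans (cong (x +_) (sym d≡1)) x+d≡b))) x+b≡L)
  ... | inj₂ b+d≡x = inj₂ (trans (sym b+1≡x) (trans (+-comm b 1) (cong suc b≡c₀))) ,
                     trans (m≥n⇒m⊓n≡n (subst (b ≤_) b+d≡x (m≤m+n b _))) b≡c₀
    where
    b+1≡x = trans (cong (b +_) (sym d≡1)) b+d≡x
    b≡c₀ = x+[1+x]≡L⇒x≡c₀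
      (trans (cong (b +_) (+-comm 1 b)) (trans (+-comm b (b + 1)) (trans (cong (_+ b) b+1≡x) x+b≡L)))

  crossing-diagonal : ∀ u → InBoard u → offset u ≡ 0 → offset (reflect L u) ≡ 1 →
    (position u ≡ c₀ ⊎ position u ≡ c₁) × position (reflect L u) ≡ c₀
  crossing-diagonal (x , y) (_ , y<n) off≡0 off'≡1 with ∣m-n∣≡0⇒m≡n {x} {y} off≡0
  ... | refl with +≡L⇒∣-∣≡1⇒central (m+[n∸m]≡n (≤-pred y<n)) off'≡1
  ...   | x-central , x⊓L∸x≡c₀ = subst (λ z → z ≡ c₀ ⊎ z ≡ c₁) (sym (⊓-idem x)) x-central , x⊓L∸x≡c₀

  crossing-antidiagonal : ∀ u → InBoard u → offset (reflect L u) ≡ 0 → offset u ≡ 1 →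
    (position (reflect L u) ≡ c₀ ⊎ position (reflect L u) ≡ c₁) × position u ≡ c₀
  crossing-antidiagonal (x , y) (_ , y<n) off'≡0 off≡1 with ∣m-n∣≡0⇒m≡n {x} {L ∸ y} off'≡0
  ... | refl with +≡L⇒∣-∣≡1⇒central (m∸n+n≡m (≤-pred y<n)) off≡1
  ...   | x-central , x⊓y≡c₀ = subst (λ z → z ≡ c₀ ⊎ z ≡ c₁) (sym (⊓-idem (L ∸ y))) x-central , x⊓y≡c₀

  offset-parities : ∀ u → InBoard u →
    parity (offset u) ≡ 0ℙ × parity (offset (reflect L u)) ≡ 1ℙ ⊎
    parity (offset u) ≡ 1ℙ × parity (offset (reflect L u)) ≡ 0ℙ
  offset-parities (x , y) (_ , y<n)
    with parity (offset (x , y)) | parity (offset (reflect L (x , y)))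
       | trans (parity-offset-reflect L {x} {y} (≤-pred y<n)) L-odd
  ... | 0ℙ | 0ℙ | ()
  ... | 0ℙ | 1ℙ | _ = inj₁ (refl , refl)
  ... | 1ℙ | 0ℙ | _ = inj₂ (refl , refl)
  ... | 1ℙ | 1ℙ | ()

  diagonalColour-cross : ∀ {u v w} → InBoard u → InBoard v → InBoard w →
    SameDiagonal u v → SameDiagonal (reflect L u) (reflect L w) → proj₁ u ≢ proj₁ v → proj₁ u ≢ proj₁ w →
    diagonalColour u v ≢ diagonalColour (reflect L u) (reflect L w)
  diagonalColour-cross {u} {v} {w} u∈ v∈ w∈ uv uw x≢x' x≢x'' with offset-parities u u∈
  ... | inj₁ (even , odd) = lineColour-disjoint (offset u) (offset (reflect L u)) even odd
    (SameDiagonal-position<n v∈ uv) (position≢ uv x≢x')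
    (SameDiagonal-position<n (InBoard-reflect w w∈) uw) (position≢ uw x≢x'')
    (crossing-diagonal u u∈)
  ... | inj₂ (odd , even) = λ eq → lineColour-disjoint (offset (reflect L u)) (offset u) even odd
    (SameDiagonal-position<n (InBoard-reflect w w∈) uw) (position≢ uw x≢x'')
    (SameDiagonal-position<n v∈ uv) (position≢ uv x≢x')
    (crossing-antidiagonal u u∈) (sym eq)

  edgeColour-proper : ∀ u v w → InBoard u → InBoard v → InBoard w → Adjℕ u v → Adjℕ u w → v ≢ w →
    edgeColour u v ≢ edgeColour u w
  edgeColour-proper u v w u∈ v∈ w∈ uv uw v≢w with edgeView u v u∈ v∈ uv | edgeView u w u∈ w∈ uw
  ... | along-diagonal d cv | along-diagonal d' cw = λ eq →
    diagonalColour-injective u∈ v∈ w∈ d d' (Adjℕ⇒≢ u v uv) (Adjℕ⇒≢ u w uw) v≢w (trans (sym cv) (trans eq cw))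
  ... | along-antidiagonal d cv | along-antidiagonal d' cw = λ eq →
    diagonalColour-injective (InBoard-reflect u u∈) (InBoard-reflect v v∈) (InBoard-reflect w w∈) d d'
      (Adjℕ⇒≢ u v uv) (Adjℕ⇒≢ u w uw) (λ rv≡rw → v≢w (reflect-injective rv≡rw)) (trans (sym cv) (trans eq cw))
    where
    reflect-injective : reflect L v ≡ reflect L w → v ≡ w
    reflect-injective rv≡rw =
      trans (sym (reflect-involutive v v∈)) (trans (cong (reflect L) rv≡rw) (reflect-involutive w w∈))
  ... | along-diagonal d cv | along-antidiagonal d' cw = λ eq →
    diagonalColour-cross u∈ v∈ w∈ d d' (Adjℕ⇒≢ u v uv) (Adjℕ⇒≢ u w uw) (trans (sym cv) (trans eq cw))
  ... | along-antidiagonal d cv | along-diagonal d' cw = λ eq →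
    diagonalColour-cross u∈ w∈ v∈ d' d (Adjℕ⇒≢ u w uw) (Adjℕ⇒≢ u v uv) (trans (sym cw) (trans (sym eq) cv))

  SameEdgeᴾ : Point → Point → Point → Point → Set
  SameEdgeᴾ u v u' v' = (u ≡ u' × v ≡ v') ⊎ (u ≡ v' × v ≡ u')

  L∸c₀≡c₁ : L ∸ c₀ ≡ c₁
  L∸c₀≡c₁ = trans (cong (_∸ c₀) (sym c₀+c₁≡L)) (m+n∸m≡n c₀ c₁)

  L∸c₁≡c₀ : L ∸ c₁ ≡ c₀
  L∸c₁≡c₀ = trans (cong (_∸ c₁) (sym c₀+c₁≡L)) (m+n∸n≡m c₀ c₁)

  on-main-diagonal : ∀ {w p} → offset w ≡ 0 → position w ≡ p → w ≡ (p , p)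
  on-main-diagonal off≡0 pw≡p = trans (offset≡0 off≡0) (cong₂ _,_ pw≡p pw≡p)

  diagonalColour≡0 : ∀ {u v} → SameDiagonal u v → diagonalColour u v ≡ 0 → SameEdgeᴾ u v (c₀ , c₀) (c₁ , c₁)
  diagonalColour≡0 {u} {v} uv c≡0 with lineColour≡0 (offset u) (position u) (position v) c≡0
  ... | off≡0 , cp = Sum.map (Product.map onMain-u onMain-v) (Product.map onMain-u onMain-v) cp
    where
    onMain-u : ∀ {p} → position u ≡ p → u ≡ (p , p)
    onMain-u = on-main-diagonal off≡0
    onMain-v : ∀ {p} → position v ≡ p → v ≡ (p , p)
    onMain-v = on-main-diagonal (trans (sym (SameDiagonal⇒offset≡ uv)) off≡0)

  unreflect : ∀ {w p q} → InBoard w → L ∸ p ≡ q → reflect L w ≡ (p , p) → w ≡ (p , q)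
  unreflect {w} {p} w∈ L∸p≡q rw≡pp =
    trans (sym (reflect-involutive w w∈)) (trans (cong (reflect L) rw≡pp) (cong (p ,_) L∸p≡q))

  edgeColour≡0 : ∀ u v → InBoard u → InBoard v → Adjℕ u v → edgeColour u v ≡ 0 →
    SameEdgeᴾ u v (c₀ , c₀) (c₁ , c₁) ⊎ SameEdgeᴾ u v (c₀ , c₁) (c₁ , c₀)
  edgeColour≡0 u v u∈ v∈ uv c≡0 with edgeView u v u∈ v∈ uv
  ... | along-diagonal d cv     = inj₁ (diagonalColour≡0 d (trans (sym cv) c≡0))
  ... | along-antidiagonal d cv = inj₂ (Sum.map
    (Product.map (unreflect u∈ L∸c₀≡c₁) (unreflect v∈ L∸c₁≡c₀))
    (Product.map (unreflect u∈ L∸c₁≡c₀) (unreflect v∈ L∸c₀≡c₁))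
    (diagonalColour≡0 d (trans (sym cv) c≡0)))

  diagonalColour-centre : diagonalColour (c₀ , c₀) (c₁ , c₁) ≡ 0
  diagonalColour-centre = begin
    lineColour ∣ c₀ - c₀ ∣ (c₀ ⊓ c₀) (c₁ ⊓ c₁) ≡⟨ cong (λ r → lineColour r (c₀ ⊓ c₀) (c₁ ⊓ c₁)) (∣n-n∣≡0 c₀) ⟩
    centreLineColour (c₀ ⊓ c₀) (c₁ ⊓ c₁)     ≡⟨ cong₂ centreLineColour (⊓-idem c₀) (⊓-idem c₁) ⟩
    centreLineColour c₀ c₁                   ≡⟨ centreLineColour-centre (inj₁ (refl , refl)) ⟩
    0                                        ∎
    where open ≡-Reasoning

  edgeColour-centre-diagonal : edgeColour (c₀ , c₀) (c₁ , c₁) ≡ 0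
  edgeColour-centre-diagonal =
    trans (edgeColour-diagonal {c₀ , c₀} {c₁ , c₁} (same-diagonal (+-comm c₀ c₁))) diagonalColour-centre

  edgeColour-centre-antidiagonal : edgeColour (c₀ , c₁) (c₁ , c₀) ≡ 0
  edgeColour-centre-antidiagonal = trans (edgeColour-antidiagonal {c₀ , c₁} {c₁ , c₀} not-diagonal)
    (trans (cong₂ diagonalColour (cong (c₀ ,_) L∸c₁≡c₀) (cong (c₁ ,_) L∸c₀≡c₁)) diagonalColour-centre)
    where
    not-diagonal : ¬ SameDiagonal (c₀ , c₁) (c₁ , c₀)
    not-diagonal (same-diagonal eq) = c₀≢c₁ (double-injective c₀ c₁ eq)

mod-injective : ∀ {a b D} .{{_ : NonZero D}} → a < D → b < D → a mod D ≡ b mod D → a ≡ b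
mod-injective {a} {b} {D} a<D b<D eq = begin
  a              ≡⟨ m<n⇒m%n≡m a<D ⟨
  a % D          ≡⟨ Fin.toℕ-fromℕ< (m%n<n a D) ⟨
  toℕ (a mod D)  ≡⟨ cong toℕ eq ⟩
  toℕ (b mod D)  ≡⟨ Fin.toℕ-fromℕ< (m%n<n b D) ⟩
  b % D          ≡⟨ m<n⇒m%n≡m b<D ⟩
  b              ∎
  where open ≡-Reasoning

module _ (j : ℕ) where
  open Construction j

  private
    N : ℕ
    N = 2 * suc (suc j)

  n≡N : n ≡ N
  n≡N = lemma j
    where
    lemma : ∀ j → suc (suc (suc (suc (j + j)))) ≡ 2 * suc (suc j)
    lemma = solve-∀

  toPoint : Square N N → Point
  toPoint (x , y) = toℕ x , toℕ y

  toPoint-injective : ∀ {u v} → toPoint u ≡ toPoint v → u ≡ v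
  toPoint-injective eq = cong₂ _,_ (Fin.toℕ-injective (cong proj₁ eq)) (Fin.toℕ-injective (cong proj₂ eq))

  InBoard-toPoint : ∀ u → InBoard (toPoint u)
  InBoard-toPoint (x , y) =
    subst (toℕ x <_) (sym n≡N) (Fin.toℕ<n x) , subst (toℕ y <_) (sym n≡N) (Fin.toℕ<n y)

  toFin : ∀ {c} → c < n → Fin N
  toFin {c} c<n = fromℕ< (subst (c <_) n≡N c<n)

  toℕ-toFin : ∀ {c} (c<n : c < n) → toℕ (toFin c<n) ≡ c
  toℕ-toFin {c} c<n = Fin.toℕ-fromℕ< (subst (c <_) n≡N c<n)

  M≤Δ : M ≤ Δ N N
  M≤Δ = begin
    M                                        ≡⟨ M≡1+l+l j ⟩
    suc l + l                                ≤⟨ degree-centre middle opposite-middle ⟩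
    degree (inject₁ middle , inject₁ middle) ≤⟨ degree≤Δ (inject₁ middle , inject₁ middle) ⟩
    Δ N N                                    ∎
    where
    open ≤-Reasoning
    -- N = 2 * (j + 2) computes to suc (suc l), the board size in degree-centre.
    l = j + suc (suc (j + 0))
    M≡1+l+l : ∀ j → suc (suc (suc (suc (j + j)))) + suc (j + j) ≡ suc (j + suc (suc (j + 0))) + (j + suc (suc (j + 0)))
    M≡1+l+l = solve-∀
    l≡c₀+c₀ : l ≡ c₀ + c₀
    l≡c₀+c₀ = lemma′ j
      where
      lemma′ : ∀ j → j + suc (suc (j + 0)) ≡ suc j + suc j
      lemma′ = solve-∀
    c₀<1+l : c₀ < suc l
    c₀<1+l = s≤s (subst (c₀ ≤_) (sym l≡c₀+c₀) (m≤m+n c₀ c₀))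
    middle : Fin (suc l)
    middle = fromℕ< c₀<1+l
    opposite-middle : opposite middle ≡ middle
    opposite-middle = Fin.toℕ-injective (begin-equality
      toℕ (opposite middle) ≡⟨ Fin.opposite-prop middle ⟩
      l ∸ toℕ middle        ≡⟨ cong₂ _∸_ l≡c₀+c₀ (Fin.toℕ-fromℕ< c₀<1+l) ⟩
      (c₀ + c₀) ∸ c₀        ≡⟨ m+n∸m≡n c₀ c₀ ⟩
      c₀                    ≡⟨ Fin.toℕ-fromℕ< c₀<1+l ⟨
      toℕ middle            ∎)

  instance
    Δ-nonZero : NonZero (Δ N N)
    Δ-nonZero = >-nonZero (≤-trans (s≤s z≤n) M≤Δ)

  colouring : Square N N → Square N N → Fin (Δ N N)
  colouring u v = edgeColour (toPoint u) (toPoint v) mod Δ N N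

  colour<Δ : ∀ u v → edgeColour (toPoint u) (toPoint v) < Δ N N
  colour<Δ u v = <-≤-trans (edgeColour-< (toPoint u) (toPoint v)) M≤Δ

  colouring-symmetric : IsEdgeColoring colouring
  colouring-symmetric u v uv = cong (_mod Δ N N) (edgeColour-comm _ _ (InBoard-toPoint u) (InBoard-toPoint v) uv)

  colouring-proper : IsProper colouring
  colouring-proper u v w uv uw v≢w eq = edgeColour-proper (toPoint u) (toPoint v) (toPoint w)
    (InBoard-toPoint u) (InBoard-toPoint v) (InBoard-toPoint w) uv uw (v≢w ∘ toPoint-injective)
    (mod-injective (colour<Δ u v) (colour<Δ u w) eq)

  SameEdge-toPoint : ∀ {a b u v p q} → toPoint u ≡ p → toPoint v ≡ q →
    SameEdgeᴾ (toPoint a) (toPoint b) p q → SameEdge a b u v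
  SameEdge-toPoint u↦p v↦q = Sum.map (Product.map (↦u u↦p) (↦u v↦q)) (Product.map (↦u v↦q) (↦u u↦p))
    where
    ↦u : ∀ {a w p} → toPoint w ≡ p → toPoint a ≡ p → a ≡ w
    ↦u w↦p a↦p = toPoint-injective (trans a↦p (sym w↦p))

  colour-on-exactly-two-edges :
    Σ[ C ∈ ProperEdgeColoring N N (Δ N N) ] ∃[ i ] ColorOnExactlyTwoEdges (proj₁ C) i
  colour-on-exactly-two-edges =
    (colouring , colouring-symmetric , colouring-proper) ,
    0 mod Δ N N , u₀ , v₀ , u₁ , v₁ ,
    (refl , 1≤∣c₀-c₁∣) , cong (_mod Δ N N) (trans (cong₂ edgeColour u₀↦ v₀↦) edgeColour-centre-diagonal) ,
    (∣-∣-comm (toℕ c₀F) (toℕ c₁F) , 1≤∣c₀-c₁∣) ,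
      cong (_mod Δ N N) (trans (cong₂ edgeColour u₁↦ v₁↦) edgeColour-centre-antidiagonal) ,
    distinct , only
    where
    c₀F = toFin (≤-trans c₀<L (n≤1+n L))
    c₁F = toFin (≤-trans c₁<L (n≤1+n L))
    c₀F↦ = toℕ-toFin (≤-trans c₀<L (n≤1+n L))
    c₁F↦ = toℕ-toFin (≤-trans c₁<L (n≤1+n L))
    u₀ v₀ u₁ v₁ : Square N N
    u₀ = c₀F , c₀F
    v₀ = c₁F , c₁F
    u₁ = c₀F , c₁F
    v₁ = c₁F , c₀F
    u₀↦ = cong₂ _,_ c₀F↦ c₀F↦
    v₀↦ = cong₂ _,_ c₁F↦ c₁F↦
    u₁↦ = cong₂ _,_ c₀F↦ c₁F↦
    v₁↦ = cong₂ _,_ c₁F↦ c₀F↦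
    c₀F≢c₁F : c₀F ≢ c₁F
    c₀F≢c₁F eq = c₀≢c₁ (trans (sym c₀F↦) (trans (cong toℕ eq) c₁F↦))
    1≤∣c₀-c₁∣ : 1 ≤ ∣ toℕ c₀F - toℕ c₁F ∣
    1≤∣c₀-c₁∣ = ≢⇒1≤∣-∣ (c₀F≢c₁F ∘ Fin.toℕ-injective)
    distinct : ¬ SameEdge u₀ v₀ u₁ v₁
    distinct (inj₁ (u₀≡u₁ , _)) = c₀F≢c₁F (cong proj₂ u₀≡u₁)
    distinct (inj₂ (u₀≡v₁ , _)) = c₀F≢c₁F (cong proj₁ u₀≡v₁)
    only : ∀ a b → Adj a b → colouring a b ≡ 0 mod Δ N N → SameEdge a b u₀ v₀ ⊎ SameEdge a b u₁ v₁
    only a b ab eq = Sum.map (SameEdge-toPoint u₀↦ v₀↦) (SameEdge-toPoint u₁↦ v₁↦)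
      (edgeColour≡0 (toPoint a) (toPoint b) (InBoard-toPoint a) (InBoard-toPoint b) ab
        (mod-injective (colour<Δ a b) (<-≤-trans (s≤s z≤n) M≤Δ) eq))

lemma5 : (k : ℕ) → 1 ≤ k →
    (Σ[ C ∈ ProperEdgeColoring (2 * k) (2 * k) (Δ (2 * k) (2 * k)) ]
       ∃[ i ] ColorOnExactlyTwoEdges (proj₁ C) i)
    × ¬ (Σ[ C ∈ ProperEdgeColoring (2 * k) (2 * k) (Δ (2 * k) (2 * k)) ]
       ∃[ i ] ColorOnExactlyOneEdge (proj₁ C) i)
lemma5 zero ()
lemma5 1 _ = colour-on-exactly-two-edges-2×2 , no-colour-on-exactly-one-edge 1 1
lemma5 k@(suc (suc j)) _ = colour-on-exactly-two-edges j , no-colour-on-exactly-one-edge k k
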